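{- Let $\Gamma$ be a finite, simple, strongly connected digraph of order $n\geq 4$ with $\dim(\Gamma)=n-2$. Suppose $x_0,x_1,x_2$ are vertices such that $(x_0,x_1),(x_1,x_2),(x_2,x_0)$ are arcs and $\partial(x_0,x_2)=2$. Let $X_1=\{x\mid \partial(x_0,x)=1\}$ and $X_2=\{x\mid\partial(x_0,x)=2\}$. If $X_1$ is neither a clique nor an independent set and $|X_2|=1$, then $\Gamma$ is isomorphic to $G_2[K_1,P_2,K_1]$.
   Context: $\partial(x,y)$ is the length of a shortest directed path from $x$ to $y$; $\tilde\partial(x,y)=(\partial(x,y),\partial(y,x))$. A vertex set $\{w_1,\dots,w_m\}$ is weakly resolving if $(\tilde\partial(w_1,u),\dots,\tilde\partial(w_m,u))\neq(\tilde\partial(w_1,v),\dots,\tilde\partial(w_m,v))$ for all distinct $u,v$; $\dim(\Gamma)$ is the minimum size of such a set. A clique is a vertex set $S$ with $\tilde\partial(x,y)=(1,1)$ for all distinct $x,y\in S$; an independent set is a vertex set with no arcs between its vertices. $K_1$ is the one-vertex digraph; $P_2$ is the digraph on two vertices $a,b$ with the single arc $(a,b)$. $G_2$ is the digraph on $\{0,1,2\}$ with arcs $(0,1),(1,0),(1,2),(2,1),(2,0)$. For a digraph $G$ on $\{0,\dots,m-1\}$ and vertex-disjoint digraphs $H_0,\dots,H_{m-1}$, $G[H_0,\dots,H_{m-1}]$ has vertex set $\bigcup V(H_i)$, and for $x\in V(H_i)$, $y\in V(H_j)$, $(x,y)$ is an arc iff either $i=j$ and $(x,y)$ is an arc of $H_i$,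 or $i\neq j$ and $(i,j)$ is an arc of $G$. -}

module Defs where

open import Data.Nat using (ℕ; zero; suc; _≤_)
open import Data.Bool using (Bool; true; false)
open import Data.Fin using (Fin; zero; suc; _≟_)
open import Data.Fin.Subset using (Subset; _∈_; ∣_∣)
open import Data.Product using (Σ; ∃; _×_; _,_)
open import Relation.Binary.PropositionalEquality using (_≡_; _≢_; refl)
open import Relation.Nullary using (¬_; yes; no)

-- Being a relation, there are no multiple arcs; simplicity additionally
-- requires looplessness.
DigraphOn : Set → Set
DigraphOn V = V → V → Bool

module _ {V : Set} (A : DigraphOn V) where

  Arc : V → V → Set
  Arc x y = A x y ≡ true

  Loopless : Set
  Loopless = ∀ x → A x x ≡ false

  data Walk : V → V → ℕ → Set where
    nil  : ∀ {x} → Walk x x zero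
    cons : ∀ {x y z k} → Arc x y → Walk y z k → Walk x z (suc k)

  IsDist : V → V → ℕ → Set
  IsDist x y d = Walk x y d × (∀ k → Walk x y k → d ≤ k)

  StronglyConnected : Set
  StronglyConnected = ∀ x y → ∃ λ k → Walk x y k

  Distinguishes : V → V → V → Set
  Distinguishes w u v =
    ¬ (∃ λ a → ∃ λ b → IsDist w u a × IsDist w v a × IsDist u w b × IsDist v w b)

  IsClique : (V → Set) → Set
  IsClique S = ∀ x y → S x → S y → x ≢ y → IsDist x y 1 × IsDist y x 1

  IsIndependent : (V → Set) → Set
  IsIndependent S = ∀ x y → S x → S y → ¬ Arc x y

module _ {n : ℕ} (A : DigraphOn (Fin n)) where

  WeaklyResolving : Subset n → Set
  WeaklyResolving W = ∀ u v → u ≢ v → ∃ λ w → w ∈ W × Distinguishes A w u v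

  HasDim : ℕ → Set
  HasDim d = (∃ λ W → WeaklyResolving W × ∣ W ∣ ≡ d)
           × (∀ W → WeaklyResolving W → d ≤ ∣ W ∣)

Isomorphic : {V U : Set} → DigraphOn V → DigraphOn U → Set
Isomorphic {V} {U} A B =
  Σ (V → U) λ f → (∀ u → ∃ λ x → f x ≡ u)
                × (∀ x y → f x ≡ f y → x ≡ y)
                × (∀ x y → A x y ≡ B (f x) (f y))

Compose : {m : ℕ} (G : DigraphOn (Fin m)) (k : Fin m → ℕ)
          (H : (i : Fin m) → DigraphOn (Fin (k i)))
        → DigraphOn (Σ (Fin m) (λ i → Fin (k i)))
Compose G k H (i , a) (j , b) with i ≟ j
... | yes refl = H i a b
... | no _     = G i j

K₁ : DigraphOn (Fin 1)
K₁ _ _ = false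

P₂ : DigraphOn (Fin 2)
P₂ zero (suc zero) = true
P₂ _    _          = false

G₂ : DigraphOn (Fin 3)
G₂ zero       (suc zero)       = true
G₂ (suc zero) zero             = true
G₂ (suc zero) (suc (suc zero)) = true
G₂ (suc (suc zero)) (suc zero) = true
G₂ (suc (suc zero)) zero       = true
G₂ _ _ = false

sizes : Fin 3 → ℕ
sizes zero             = 1
sizes (suc zero)       = 2
sizes (suc (suc zero)) = 1

parts : (i : Fin 3) → DigraphOn (Fin (sizes i))
parts zero             = K₁
parts (suc zero)       = P₂
parts (suc (suc zero)) = K₁

G₂[K₁,P₂,K₁] : DigraphOn (Σ (Fin 3) (λ i → Fin (sizes i)))
G₂[K₁,P₂,K₁] = Compose G₂ sizes parts

{-# OPTIONS --safe #-}

-- Since dim(Γ) = n − 2, no three vertices can have each of their pairs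
-- distinguished by a vertex outside the triple: the other n − 3 vertices
-- would then form a weakly resolving set.  With x₀ as the distinguishing
-- vertex this puts every vertex other than x₀, x₂ into X₁, and shows that no
-- vertex of X₁ distinguishes two others by arcs; so if |X₁| ≥ 3 all arcs
-- inside X₁ are present or all are absent.  Hence X₁ = {a, b} with the single
-- arc a → b, n = 4, and the same triple argument, once for each of the six
-- undetermined arcs, forces the arcs of G₂[K₁, P₂, K₁].

module Submission where

open import Defs
open import Data.Nat using (ℕ; zero; suc; _≤_; _<_; _∸_; _+_; z≤n; s≤s)
open import Data.Nat.Properties using (≤-antisym; ≤-trans; <-irrefl; <⇒≱; 1+n≰n; module ≤-Reasoning)
open import Data.Fin using (Fin; zero; suc; _≟_)
open import Data.Fin.Properties using (any?)
open import Data.Fin.Subset using (Subset; ⊤; _-_; _∈_; _∉_; ∣_∣)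
open import Data.Fin.Subset.Properties using (_∈?_; ∈⊤; x∈p∧x≢y⇒x∈p-y; x∈p⇒∣p-x∣<∣p∣; ∣p∣≤n)
open import Data.Bool using (true; false)
import Data.Bool.Properties as Bool
open import Data.Product using (Σ; ∃; _×_; _,_; proj₁; proj₂)
open import Data.Sum using (_⊎_; inj₁; inj₂)
open import Data.Empty using (⊥; ⊥-elim)
open import Function using (_∘_)
open import Relation.Binary.Definitions using (DecidableEquality)
open import Relation.Binary.PropositionalEquality
  using (_≡_; _≢_; refl; sym; trans; cong; cong₂; subst; ≢-sym; module ≡-Reasoning)
open import Relation.Nullary using (¬_; Dec; yes; no; contradiction)
open import Relation.Nullary.Decidable using (decidable-stable; map′; ¬?; _×-dec_)
open import Relation.Unary using (Decidable)

module Distances {V : Set} (A : DigraphOn V) where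

  walk₀⇒≡ : ∀ {x y} → Walk A x y 0 → x ≡ y
  walk₀⇒≡ nil = refl

  IsDist-functional : ∀ {x y a b} → IsDist A x y a → IsDist A x y b → a ≡ b
  IsDist-functional (walkᵃ , minᵃ) (walkᵇ , minᵇ) = ≤-antisym (minᵃ _ walkᵇ) (minᵇ _ walkᵃ)

  IsDist-refl : ∀ {x} → IsDist A x x 0
  IsDist-refl = nil , λ _ _ → z≤n

  IsDist⇒≢ : ∀ {x y k} → IsDist A x y (suc k) → x ≢ y
  IsDist⇒≢ d refl = contradiction (IsDist-functional d IsDist-refl) λ ()

  arc⇒IsDist1 : ∀ {x y} → x ≢ y → Arc A x y → IsDist A x y 1
  arc⇒IsDist1 x≢y x→y = cons x→y nil , λ
    { zero    walk → ⊥-elim (x≢y (walk₀⇒≡ walk))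
    ; (suc _) _    → s≤s z≤n
    }

  IsDist1⇒arc : ∀ {x y} → IsDist A x y 1 → Arc A x y
  IsDist1⇒arc (cons x→y nil , _) = x→y

  IsDist1? : DecidableEquality V → ∀ x y → Dec (IsDist A x y 1)
  IsDist1? _≟ᵥ_ x y =
    map′ (λ (x≢y , x→y) → arc⇒IsDist1 x≢y x→y) (λ d → IsDist⇒≢ d , IsDist1⇒arc d)
         (¬? (x ≟ᵥ y) ×-dec (A x y Bool.≟ true))

  false⇒¬Arc : ∀ {x y} → A x y ≡ false → ¬ Arc A x y
  false⇒¬Arc x↛y x→y = Bool.not-¬ x→y x↛y

  arc-by-contradiction : ∀ {x y} → (A x y ≡ false → ⊥) → Arc A x y
  arc-by-contradiction h = decidable-stable (_ Bool.≟ true) (h ∘ Bool.¬-not)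

  unsnoc : ∀ {x y k} → Walk A x y (suc k) → ∃ λ m → Walk A x m k × Arc A m y
  unsnoc (cons x→y nil)          = _ , nil , x→y
  unsnoc (cons x→m (cons m→ walk)) with unsnoc (cons m→ walk)
  ... | l , walk′ , l→y = l , cons x→m walk′ , l→y

  sole-out-neighbour⇒< : ∀ {x y w k k′} → (∀ m → Arc A y m → m ≡ x) → y ≢ w →
                         IsDist A y w k → IsDist A x w k′ → k′ < k
  sole-out-neighbour⇒< sole y≢w (nil , _) _ = ⊥-elim (y≢w refl)
  sole-out-neighbour⇒< sole y≢w (cons y→m walk , _) (_ , min) with sole _ y→m
  ... | refl = s≤s (min _ walk)

  sole-in-neighbour⇒< : ∀ {x y w k k′} → (∀ m → Arc A m y → m ≡ x) → w ≢ y →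
                        IsDist A w y k → IsDist A w x k′ → k′ < k
  sole-in-neighbour⇒< {k = zero}  sole w≢y (walk , _) _ = ⊥-elim (w≢y (walk₀⇒≡ walk))
  sole-in-neighbour⇒< {k = suc _} sole w≢y (walk , _) (_ , min) with unsnoc walk
  ... | m , walk′ , m→y with sole m m→y
  ... | refl = s≤s (min _ walk′)

  distinguishes-out : ∀ {w u v} → (∀ {k} → IsDist A w u k → ¬ IsDist A w v k) →
                      Distinguishes A w u v
  distinguishes-out h (_ , _ , w⇝u , w⇝v , _ , _) = h w⇝u w⇝v

  distinguishes-in : ∀ {w u v} → (∀ {k} → IsDist A u w k → ¬ IsDist A v w k) →
                     Distinguishes A w u v
  distinguishes-in h (_ , _ , _ , _ , u⇝w , v⇝w) = h u⇝w v⇝w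

  Distinguishes-sym : ∀ {w u v} → Distinguishes A w u v → Distinguishes A w v u
  Distinguishes-sym d (a , b , w⇝u , w⇝v , u⇝w , v⇝w) = d (a , b , w⇝v , w⇝u , v⇝w , u⇝w)

  distinguishes-self : ∀ {u v} → u ≢ v → Distinguishes A u u v
  distinguishes-self u≢v = distinguishes-out λ u⇝u u⇝v →
    u≢v (walk₀⇒≡ (proj₁ (subst (IsDist A _ _) (IsDist-functional u⇝u IsDist-refl) u⇝v)))

  arc-distinguishes-out : ∀ {w u v} → w ≢ u → Arc A w u → A w v ≡ false →
                          Distinguishes A w u v
  arc-distinguishes-out w≢u w→u w↛v = distinguishes-out λ w⇝u w⇝v →
    false⇒¬Arc w↛v (IsDist1⇒arc (subst (IsDist A _ _) (IsDist-functional w⇝u (arc⇒IsDist1 w≢u w→u)) w⇝v))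

  arc-distinguishes-in : ∀ {w u v} → u ≢ w → Arc A u w → A v w ≡ false →
                         Distinguishes A w u v
  arc-distinguishes-in u≢w u→w v↛w = distinguishes-in λ u⇝w v⇝w →
    false⇒¬Arc v↛w (IsDist1⇒arc (subst (IsDist A _ _) (IsDist-functional u⇝w (arc⇒IsDist1 u≢w u→w)) v⇝w))

  arcs-differ⇒distinguishes-out : ∀ {w u v} → w ≢ u → w ≢ v → A w u ≢ A w v →
                                  Distinguishes A w u v
  arcs-differ⇒distinguishes-out {w} {u} {v} w≢u w≢v differ with A w u in w→u | A w v in w→v
  ... | true  | true  = ⊥-elim (differ refl)
  ... | true  | false = arc-distinguishes-out w≢u w→u w→v
  ... | false | true  = Distinguishes-sym (arc-distinguishes-out w≢v w→v w→u)
  ... | false | false = ⊥-elim (differ refl)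

  arcs-differ⇒distinguishes-in : ∀ {w u v} → u ≢ w → v ≢ w → A u w ≢ A v w →
                                 Distinguishes A w u v
  arcs-differ⇒distinguishes-in {w} {u} {v} u≢w v≢w differ with A u w in u→w | A v w in v→w
  ... | true  | true  = ⊥-elim (differ refl)
  ... | true  | false = arc-distinguishes-in u≢w u→w v→w
  ... | false | true  = Distinguishes-sym (arc-distinguishes-in v≢w v→w u→w)
  ... | false | false = ⊥-elim (differ refl)

Isomorphic-sym : ∀ {V U} {A : DigraphOn V} {B : DigraphOn U} → Isomorphic A B → Isomorphic B A
Isomorphic-sym {V} {U} {A} {B} (f , f-surjective , f-injective , f-preserves) =
  f⁻¹ , f⁻¹-surjective , f⁻¹-injective , f⁻¹-preserves
  where
  f⁻¹ : U → V
  f⁻¹ u = proj₁ (f-surjective u)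

  f∘f⁻¹ : ∀ u → f (f⁻¹ u) ≡ u
  f∘f⁻¹ u = proj₂ (f-surjective u)

  f⁻¹-surjective : ∀ x → ∃ λ u → f⁻¹ u ≡ x
  f⁻¹-surjective x = f x , f-injective _ _ (f∘f⁻¹ (f x))

  f⁻¹-injective : ∀ u v → f⁻¹ u ≡ f⁻¹ v → u ≡ v
  f⁻¹-injective u v e = trans (sym (f∘f⁻¹ u)) (trans (cong f e) (f∘f⁻¹ v))

  f⁻¹-preserves : ∀ u v → B u v ≡ A (f⁻¹ u) (f⁻¹ v)
  f⁻¹-preserves u v = begin
    B u v                     ≡⟨ sym (cong₂ B (f∘f⁻¹ u) (f∘f⁻¹ v)) ⟩
    B (f (f⁻¹ u)) (f (f⁻¹ v)) ≡⟨ sym (f-preserves _ _) ⟩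
    A (f⁻¹ u) (f⁻¹ v)         ∎
    where open ≡-Reasoning

module Homogeneous {V : Set} (_≟ᵥ_ : DecidableEquality V) (A : DigraphOn V) (S : V → Set)
  (row    : ∀ {w u v} → S w → S u → S v → w ≢ u → w ≢ v → u ≢ v → A w u ≡ A w v)
  (column : ∀ {w u v} → S w → S u → S v → w ≢ u → w ≢ v → u ≢ v → A u w ≡ A v w) where

  module _ {p q c} (Sp : S p) (Sq : S q) (Sc : S c) (p≢q : p ≢ q) (c≢p : c ≢ p) (c≢q : c ≢ q) where
    private
      reversed : A q p ≡ A p q
      reversed = begin
        A q p ≡⟨ row Sq Sp Sc (≢-sym p≢q) (≢-sym c≢q) (≢-sym c≢p) ⟩
        A q c ≡⟨ column Sc Sq Sp c≢q c≢p (≢-sym p≢q) ⟩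
        A p c ≡⟨ row Sp Sc Sq (≢-sym c≢p) p≢q c≢q ⟩
        A p q ∎
        where open ≡-Reasoning

      from-p : ∀ {y} → S y → p ≢ y → A p y ≡ A p q
      from-p {y} Sy p≢y with y ≟ᵥ q
      ... | yes refl = refl
      ... | no y≢q   = row Sp Sy Sq p≢y p≢q y≢q

      into-p : ∀ {x} → S x → x ≢ p → A x p ≡ A p q
      into-p {x} Sx x≢p with x ≟ᵥ q
      ... | yes refl = reversed
      ... | no x≢q   = trans (column Sp Sx Sq (≢-sym x≢p) p≢q x≢q) reversed

    arcs-uniform : ∀ {a b} → S a → S b → a ≢ b → A a b ≡ A p q
    arcs-uniform {a} {b} Sa Sb a≢b with a ≟ᵥ p | b ≟ᵥ p
    ... | yes refl | _        = from-p Sb a≢b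
    ... | no a≢p   | yes refl = into-p Sa a≢p
    ... | no a≢p   | no b≢p   = trans (row Sa Sb Sp a≢b a≢p b≢p) (into-p Sa a≢p)

module _ {n : ℕ} (A : DigraphOn (Fin n)) where
  open Distances A

  resolving-if-outsiders-distinguished : (W : Subset n) →
    (∀ u v → u ∉ W → v ∉ W → u ≢ v → ∃ λ w → w ∈ W × Distinguishes A w u v) →
    WeaklyResolving A W
  resolving-if-outsiders-distinguished W h u v u≢v with u ∈? W | v ∈? W
  ... | yes u∈W | _       = u , u∈W , distinguishes-self u≢v
  ... | no _    | yes v∈W = v , v∈W , Distinguishes-sym (distinguishes-self (≢-sym u≢v))
  ... | no u∉W  | no v∉W  = h u v u∉W v∉W u≢v

  module _ {S : Fin n → Set} (S? : Decidable S) where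

    ¬IsIndependent⇒arc : ¬ IsIndependent A S → ∃ λ a → ∃ λ b → S a × S b × Arc A a b
    ¬IsIndependent⇒arc ¬independent =
      decidable-stable (any? λ a → any? λ b → S? a ×-dec S? b ×-dec (A a b Bool.≟ true))
        λ none → ¬independent λ a b Sa Sb a→b → none (a , b , Sa , Sb , a→b)

    ¬IsClique⇒non-arc : ¬ IsClique A S → ∃ λ p → ∃ λ q → S p × S q × p ≢ q × A p q ≡ false
    ¬IsClique⇒non-arc ¬clique =
      decidable-stable
        (any? λ p → any? λ q → S? p ×-dec S? q ×-dec ¬? (p ≟ q) ×-dec (A p q Bool.≟ false))
        λ none → ¬clique λ x y Sx Sy x≢y →
          let arc : ∀ {x y} → S x → S y → x ≢ y → Arc A x y
              arc Sx Sy x≢y = arc-by-contradiction λ x↛y → none (_ , _ , Sx , Sy , x≢y , x↛y)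
          in arc⇒IsDist1 x≢y (arc Sx Sy x≢y) , arc⇒IsDist1 (≢-sym x≢y) (arc Sy Sx (≢-sym x≢y))

module Dim≡n∸2 {n : ℕ} {A : DigraphOn (Fin n)} (dim : HasDim A (n ∸ 2)) where

  DistinguishedOutside : Fin n → Fin n → Fin n → Fin n → Fin n → Set
  DistinguishedOutside p q r u v = ∃ λ w → w ≢ p × w ≢ q × w ≢ r × Distinguishes A w u v

  no-triple-distinguished-outside : ∀ {p q r} → p ≢ q → p ≢ r → q ≢ r →
    DistinguishedOutside p q r p q → DistinguishedOutside p q r p r →
    DistinguishedOutside p q r q r → ⊥
  no-triple-distinguished-outside {p} {q} {r} p≢q p≢r q≢r dpq dpr dqr =
    n∸2≤m⇒3+m≰n (proj₂ dim W W-resolving) 3+∣W∣≤n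
    where
    open Distances A

    W : Subset n
    W = ⊤ - p - q - r

    ∈W : ∀ {w} → w ≢ p → w ≢ q → w ≢ r → w ∈ W
    ∈W w≢p w≢q w≢r = x∈p∧x≢y⇒x∈p-y (x∈p∧x≢y⇒x∈p-y (x∈p∧x≢y⇒x∈p-y ∈⊤ w≢p) w≢q) w≢r

    ∉W : ∀ {w} → w ∉ W → w ≡ p ⊎ w ≡ q ⊎ w ≡ r
    ∉W {w} w∉W with w ≟ p | w ≟ q | w ≟ r
    ... | yes w≡p | _       | _       = inj₁ w≡p
    ... | no _    | yes w≡q | _       = inj₂ (inj₁ w≡q)
    ... | no _    | no _    | yes w≡r = inj₂ (inj₂ w≡r)
    ... | no w≢p  | no w≢q  | no w≢r  = ⊥-elim (w∉W (∈W w≢p w≢q w≢r))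

    3+∣W∣≤n : 3 + ∣ W ∣ ≤ n
    3+∣W∣≤n = begin-strict
      2 + ∣ ⊤ - p - q - r ∣ <⟨ s≤s (s≤s (x∈p⇒∣p-x∣<∣p∣ (x∈p∧x≢y⇒x∈p-y (x∈p∧x≢y⇒x∈p-y ∈⊤ (≢-sym p≢r)) (≢-sym q≢r)))) ⟩
      2 + ∣ ⊤ - p - q ∣     ≤⟨ s≤s (x∈p⇒∣p-x∣<∣p∣ (x∈p∧x≢y⇒x∈p-y ∈⊤ (≢-sym p≢q))) ⟩
      1 + ∣ ⊤ - p ∣         ≤⟨ x∈p⇒∣p-x∣<∣p∣ (∈⊤ {x = p}) ⟩
      ∣ ⊤ {n} ∣             ≤⟨ ∣p∣≤n ⊤ ⟩
      n                     ∎
      where open ≤-Reasoning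

    n∸2≤m⇒3+m≰n : ∀ {n m} → n ∸ 2 ≤ m → ¬ (3 + m ≤ n)
    n∸2≤m⇒3+m≰n {suc (suc _)} n≤m (s≤s (s≤s 1+m≤n)) = 1+n≰n (≤-trans 1+m≤n n≤m)

    inside : ∀ {u v} → DistinguishedOutside p q r u v → ∃ λ w → w ∈ W × Distinguishes A w u v
    inside (w , w≢p , w≢q , w≢r , d) = w , ∈W w≢p w≢q w≢r , d

    inside-sym : ∀ {u v} → DistinguishedOutside p q r u v → ∃ λ w → w ∈ W × Distinguishes A w v u
    inside-sym (w , w≢p , w≢q , w≢r , d) = w , ∈W w≢p w≢q w≢r , Distinguishes-sym d

    W-resolving : WeaklyResolving A W
    W-resolving = resolving-if-outsiders-distinguished A W λ u v u∉W v∉W u≢v →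
      pair (∉W u∉W) (∉W v∉W) u≢v
      where
      pair : ∀ {u v} → u ≡ p ⊎ u ≡ q ⊎ u ≡ r → v ≡ p ⊎ v ≡ q ⊎ v ≡ r → u ≢ v →
             ∃ λ w → w ∈ W × Distinguishes A w u v
      pair (inj₁ refl)        (inj₁ refl)        u≢v = ⊥-elim (u≢v refl)
      pair (inj₁ refl)        (inj₂ (inj₁ refl)) _   = inside dpq
      pair (inj₁ refl)        (inj₂ (inj₂ refl)) _   = inside dpr
      pair (inj₂ (inj₁ refl)) (inj₁ refl)        _   = inside-sym dpq
      pair (inj₂ (inj₁ refl)) (inj₂ (inj₁ refl)) u≢v = ⊥-elim (u≢v refl)
      pair (inj₂ (inj₁ refl)) (inj₂ (inj₂ refl)) _   = inside dqr
      pair (inj₂ (inj₂ refl)) (inj₁ refl)        _   = inside-sym dpr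
      pair (inj₂ (inj₂ refl)) (inj₂ (inj₁ refl)) _   = inside-sym dqr
      pair (inj₂ (inj₂ refl)) (inj₂ (inj₂ refl)) u≢v = ⊥-elim (u≢v refl)

  no-triple-distinguished-by : ∀ {w p q r} → w ≢ p → w ≢ q → w ≢ r → p ≢ q → p ≢ r → q ≢ r →
    Distinguishes A w p q → Distinguishes A w p r → Distinguishes A w q r → ⊥
  no-triple-distinguished-by {w} w≢p w≢q w≢r p≢q p≢r q≢r dpq dpr dqr =
    no-triple-distinguished-outside p≢q p≢r q≢r
      (w , w≢p , w≢q , w≢r , dpq) (w , w≢p , w≢q , w≢r , dpr) (w , w≢p , w≢q , w≢r , dqr)

module Proposition {n : ℕ} (A : DigraphOn (Fin n)) (loopless : Loopless A)
  (dim : HasDim A (n ∸ 2)) {x₀ x₁ x₂ : Fin n} (x₀→x₁ : Arc A x₀ x₁) (x₂→x₀ : Arc A x₂ x₀)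
  (∂x₀x₂≡2 : IsDist A x₀ x₂ 2) (x₂-unique : ∀ y → IsDist A x₀ y 2 → y ≡ x₂) where
  open Distances A
  open Dim≡n∸2 dim

  arc⇒≢ : ∀ {x y} → Arc A x y → x ≢ y
  arc⇒≢ {x} x→x refl = false⇒¬Arc (loopless x) x→x

  x₀≢x₂ : x₀ ≢ x₂
  x₀≢x₂ = IsDist⇒≢ ∂x₀x₂≡2

  x₀↛x₂ : A x₀ x₂ ≡ false
  x₀↛x₂ = Bool.¬-not λ x₀→x₂ → contradiction (IsDist-functional (arc⇒IsDist1 x₀≢x₂ x₀→x₂) ∂x₀x₂≡2) λ ()

  Middle : Fin n → Set
  Middle u = u ≢ x₀ × u ≢ x₂

  x₀-out⇒Middle : ∀ {u} → Arc A x₀ u → Middle u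
  x₀-out⇒Middle x₀→u = ≢-sym (arc⇒≢ x₀→u) , λ { refl → false⇒¬Arc x₀↛x₂ x₀→u }

  Middle⇒x₀-out : ∀ {u} → Middle u → Arc A x₀ u
  Middle⇒x₀-out {u} (u≢x₀ , u≢x₂) = arc-by-contradiction λ x₀↛u →
    no-triple-distinguished-by x₀≢x₂ (arc⇒≢ x₀→x₁) (≢-sym u≢x₀)
      (≢-sym (proj₂ (x₀-out⇒Middle x₀→x₁))) (≢-sym u≢x₂) (λ { refl → false⇒¬Arc x₀↛u x₀→x₁ })
      (Distinguishes-sym (arc-distinguishes-out (arc⇒≢ x₀→x₁) x₀→x₁ x₀↛x₂))
      (distinguishes-out λ x₀⇝x₂ x₀⇝u →
        u≢x₂ (x₂-unique u (subst (IsDist A x₀ u) (IsDist-functional x₀⇝x₂ ∂x₀x₂≡2) x₀⇝u)))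
      (arc-distinguishes-out (arc⇒≢ x₀→x₁) x₀→x₁ x₀↛u)

  x₀-distinguishes-x₂ : ∀ {u} → Middle u → Distinguishes A x₀ x₂ u
  x₀-distinguishes-x₂ Mu =
    Distinguishes-sym (arc-distinguishes-out (≢-sym (proj₁ Mu)) (Middle⇒x₀-out Mu) x₀↛x₂)

  module _ {w u v} (Mw : Middle w) (Mu : Middle u) (Mv : Middle v)
           (w≢u : w ≢ u) (w≢v : w ≢ v) (u≢v : u ≢ v) where

    Middle-not-distinguished-by-Middle : ¬ Distinguishes A w u v
    Middle-not-distinguished-by-Middle d =
      no-triple-distinguished-outside (≢-sym (proj₂ Mu)) (≢-sym (proj₂ Mv)) u≢v
        (x₀ , x₀≢x₂ , ≢-sym (proj₁ Mu) , ≢-sym (proj₁ Mv) , x₀-distinguishes-x₂ Mu)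
        (x₀ , x₀≢x₂ , ≢-sym (proj₁ Mu) , ≢-sym (proj₁ Mv) , x₀-distinguishes-x₂ Mv)
        (w , proj₂ Mw , w≢u , w≢v , d)

    Middle-row : A w u ≡ A w v
    Middle-row = decidable-stable (A w u Bool.≟ A w v)
      (Middle-not-distinguished-by-Middle ∘ arcs-differ⇒distinguishes-out w≢u w≢v)

    Middle-column : A u w ≡ A v w
    Middle-column = decidable-stable (A u w Bool.≟ A v w)
      (Middle-not-distinguished-by-Middle ∘ arcs-differ⇒distinguishes-in (≢-sym w≢u) (≢-sym w≢v))

  Middle-into-x₀ : ∀ {u v} → Middle u → Middle v → u ≢ v → A u x₀ ≡ A v x₀
  Middle-into-x₀ Mu Mv u≢v = decidable-stable (_ Bool.≟ _) λ differ →
    no-triple-distinguished-by x₀≢x₂ (≢-sym (proj₁ Mu)) (≢-sym (proj₁ Mv))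
      (≢-sym (proj₂ Mu)) (≢-sym (proj₂ Mv)) u≢v
      (x₀-distinguishes-x₂ Mu) (x₀-distinguishes-x₂ Mv)
      (arcs-differ⇒distinguishes-in (proj₁ Mu) (proj₁ Mv) differ)

  open Homogeneous _≟_ A Middle Middle-row Middle-column

  module _ {p q a b} (x₀→p : Arc A x₀ p) (x₀→q : Arc A x₀ q) (p≢q : p ≢ q) (p↛q : A p q ≡ false)
           (x₀→a : Arc A x₀ a) (x₀→b : Arc A x₀ b) (a→b : Arc A a b) where

    Middle⇒≡a⊎≡b : ∀ {c} → Middle c → c ≡ a ⊎ c ≡ b
    Middle⇒≡a⊎≡b {c} Mc with c ≟ a | c ≟ b
    ... | yes c≡a | _       = inj₁ c≡a
    ... | no _    | yes c≡b = inj₂ c≡b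
    ... | no c≢a  | no c≢b  = ⊥-elim (false⇒¬Arc p↛q (trans
      (arcs-uniform (x₀-out⇒Middle x₀→a) (x₀-out⇒Middle x₀→b) Mc (arc⇒≢ a→b) c≢a c≢b
        (x₀-out⇒Middle x₀→p) (x₀-out⇒Middle x₀→q) p≢q)
      a→b))

    b↛a : A b a ≡ false
    b↛a = from-pair (Middle⇒≡a⊎≡b (x₀-out⇒Middle x₀→p)) (Middle⇒≡a⊎≡b (x₀-out⇒Middle x₀→q))
      where
      from-pair : p ≡ a ⊎ p ≡ b → q ≡ a ⊎ q ≡ b → A b a ≡ false
      from-pair (inj₁ refl) (inj₁ refl) = ⊥-elim (p≢q refl)
      from-pair (inj₁ refl) (inj₂ refl) = ⊥-elim (false⇒¬Arc p↛q a→b)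
      from-pair (inj₂ refl) (inj₁ refl) = p↛q
      from-pair (inj₂ refl) (inj₂ refl) = ⊥-elim (p≢q refl)

    vertex-cases : ∀ c → c ≡ x₀ ⊎ c ≡ x₂ ⊎ c ≡ a ⊎ c ≡ b
    vertex-cases c with c ≟ x₀ | c ≟ x₂
    ... | yes c≡x₀ | _        = inj₁ c≡x₀
    ... | no _     | yes c≡x₂ = inj₂ (inj₁ c≡x₂)
    ... | no c≢x₀  | no c≢x₂  = inj₂ (inj₂ (Middle⇒≡a⊎≡b (c≢x₀ , c≢x₂)))

    a≢x₀ : a ≢ x₀
    a≢x₀ = proj₁ (x₀-out⇒Middle x₀→a)

    a≢x₂ : a ≢ x₂
    a≢x₂ = proj₂ (x₀-out⇒Middle x₀→a)

    b≢x₀ : b ≢ x₀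
    b≢x₀ = proj₁ (x₀-out⇒Middle x₀→b)

    b≢x₂ : b ≢ x₂
    b≢x₂ = proj₂ (x₀-out⇒Middle x₀→b)

    a≢b : a ≢ b
    a≢b = arc⇒≢ a→b

    ¬all-distinguished-by-a :
      Distinguishes A a x₀ x₂ → Distinguishes A a x₀ b → Distinguishes A a x₂ b → ⊥
    ¬all-distinguished-by-a =
      no-triple-distinguished-by a≢x₀ a≢x₂ a≢b x₀≢x₂ (≢-sym b≢x₀) (≢-sym b≢x₂)

    ¬all-distinguished-by-b :
      Distinguishes A b x₀ x₂ → Distinguishes A b x₀ a → Distinguishes A b x₂ a → ⊥
    ¬all-distinguished-by-b =
      no-triple-distinguished-by b≢x₀ b≢x₂ (≢-sym a≢b) x₀≢x₂ (≢-sym a≢x₀) (≢-sym a≢x₂)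

    ¬all-distinguished-by-x₂ :
      Distinguishes A x₂ x₀ a → Distinguishes A x₂ x₀ b → Distinguishes A x₂ a b → ⊥
    ¬all-distinguished-by-x₂ =
      no-triple-distinguished-by (≢-sym x₀≢x₂) (≢-sym a≢x₂) (≢-sym b≢x₂) (≢-sym a≢x₀) (≢-sym b≢x₀) a≢b

    only-x₂→x₀ : A a x₀ ≡ false → A b x₀ ≡ false → ∀ m → Arc A m x₀ → m ≡ x₂
    only-x₂→x₀ a↛x₀ b↛x₀ m m→x₀ with vertex-cases m
    ... | inj₁ refl                = ⊥-elim (false⇒¬Arc (loopless x₀) m→x₀)
    ... | inj₂ (inj₁ m≡x₂)         = m≡x₂
    ... | inj₂ (inj₂ (inj₁ refl))  = ⊥-elim (false⇒¬Arc a↛x₀ m→x₀)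
    ... | inj₂ (inj₂ (inj₂ refl))  = ⊥-elim (false⇒¬Arc b↛x₀ m→x₀)

    only-b→x₂ : A b x₀ ≡ false → ∀ m → Arc A b m → m ≡ x₂
    only-b→x₂ b↛x₀ m b→m with vertex-cases m
    ... | inj₁ refl                = ⊥-elim (false⇒¬Arc b↛x₀ b→m)
    ... | inj₂ (inj₁ m≡x₂)         = m≡x₂
    ... | inj₂ (inj₂ (inj₁ refl))  = ⊥-elim (false⇒¬Arc b↛a b→m)
    ... | inj₂ (inj₂ (inj₂ refl))  = ⊥-elim (false⇒¬Arc (loopless b) b→m)

    only-b→x₀ : A b x₂ ≡ false → ∀ m → Arc A b m → m ≡ x₀
    only-b→x₀ b↛x₂ m b→m with vertex-cases m
    ... | inj₁ m≡x₀                = m≡x₀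
    ... | inj₂ (inj₁ refl)         = ⊥-elim (false⇒¬Arc b↛x₂ b→m)
    ... | inj₂ (inj₂ (inj₁ refl))  = ⊥-elim (false⇒¬Arc b↛a b→m)
    ... | inj₂ (inj₂ (inj₂ refl))  = ⊥-elim (false⇒¬Arc (loopless b) b→m)

    a→x₀ : Arc A a x₀
    a→x₀ = arc-by-contradiction λ a↛x₀ →
      let b↛x₀ : A b x₀ ≡ false
          b↛x₀ = trans (sym (Middle-into-x₀ (a≢x₀ , a≢x₂) (b≢x₀ , b≢x₂) a≢b)) a↛x₀
      in ¬all-distinguished-by-a
           (distinguishes-out λ a⇝x₀ a⇝x₂ →
             <-irrefl refl (sole-in-neighbour⇒< (only-x₂→x₀ a↛x₀ b↛x₀) a≢x₀ a⇝x₀ a⇝x₂))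
           (Distinguishes-sym (arc-distinguishes-out a≢b a→b a↛x₀))
           (distinguishes-in λ x₂⇝a b⇝a →
             <-irrefl refl (sole-out-neighbour⇒< (only-b→x₂ b↛x₀) (≢-sym a≢b) b⇝a x₂⇝a))

    b→x₀ : Arc A b x₀
    b→x₀ = trans (sym (Middle-into-x₀ (a≢x₀ , a≢x₂) (b≢x₀ , b≢x₂) a≢b)) a→x₀

    -- b ↛ x₂ would route every path from b to x₂ through x₀, making ∂(b, x₂) > 2 ≥ ∂(b, a).
    b→x₂ : Arc A b x₂
    b→x₂ = arc-by-contradiction λ b↛x₂ →
      ¬all-distinguished-by-b
        (arc-distinguishes-out b≢x₀ b→x₀ b↛x₂)
        (arc-distinguishes-out b≢x₀ b→x₀ b↛a)
        (distinguishes-out λ b⇝x₂ b⇝a →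
          <⇒≱ (sole-out-neighbour⇒< (only-b→x₀ b↛x₂) b≢x₂ b⇝x₂ ∂x₀x₂≡2)
              (proj₂ b⇝a 2 (cons b→x₀ (cons x₀→a nil))))

    x₂→b : Arc A x₂ b
    x₂→b = arc-by-contradiction λ x₂↛b →
      ¬all-distinguished-by-b
        (arc-distinguishes-in (≢-sym b≢x₀) x₀→b x₂↛b)
        (arc-distinguishes-out b≢x₀ b→x₀ b↛a)
        (Distinguishes-sym (arc-distinguishes-in a≢b a→b x₂↛b))

    a→x₂ : Arc A a x₂
    a→x₂ = arc-by-contradiction λ a↛x₂ →
      ¬all-distinguished-by-a
        (arc-distinguishes-out a≢x₀ a→x₀ a↛x₂)
        (arc-distinguishes-in (≢-sym a≢x₀) x₀→a b↛a)
        (Distinguishes-sym (arc-distinguishes-out a≢b a→b a↛x₂))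

    x₂→a : Arc A x₂ a
    x₂→a = arc-by-contradiction λ x₂↛a →
      ¬all-distinguished-by-x₂
        (arc-distinguishes-out (≢-sym x₀≢x₂) x₂→x₀ x₂↛a)
        (Distinguishes-sym (arc-distinguishes-in b≢x₂ b→x₂ x₀↛x₂))
        (Distinguishes-sym (arc-distinguishes-out (≢-sym b≢x₂) x₂→b x₂↛a))

    embedding : Σ (Fin 3) (λ i → Fin (sizes i)) → Fin n
    embedding (zero , zero)           = x₀
    embedding (suc zero , zero)       = a
    embedding (suc zero , suc zero)   = b
    embedding (suc (suc zero) , zero) = x₂

    embedding-preserves : ∀ X Y → G₂[K₁,P₂,K₁] X Y ≡ A (embedding X) (embedding Y)
    embedding-preserves (zero , zero)           (zero , zero)           = sym (loopless x₀)
    embedding-preserves (zero , zero)           (suc zero , zero)       = sym x₀→a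
    embedding-preserves (zero , zero)           (suc zero , suc zero)   = sym x₀→b
    embedding-preserves (zero , zero)           (suc (suc zero) , zero) = sym x₀↛x₂
    embedding-preserves (suc zero , zero)       (zero , zero)           = sym a→x₀
    embedding-preserves (suc zero , zero)       (suc zero , zero)       = sym (loopless a)
    embedding-preserves (suc zero , zero)       (suc zero , suc zero)   = sym a→b
    embedding-preserves (suc zero , zero)       (suc (suc zero) , zero) = sym a→x₂
    embedding-preserves (suc zero , suc zero)   (zero , zero)           = sym b→x₀
    embedding-preserves (suc zero , suc zero)   (suc zero , zero)       = sym b↛a
    embedding-preserves (suc zero , suc zero)   (suc zero , suc zero)   = sym (loopless b)
    embedding-preserves (suc zero , suc zero)   (suc (suc zero) , zero) = sym b→x₂
    embedding-preserves (suc (suc zero) , zero) (zero , zero)           = sym x₂→x₀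
    embedding-preserves (suc (suc zero) , zero) (suc zero , zero)       = sym x₂→a
    embedding-preserves (suc (suc zero) , zero) (suc zero , suc zero)   = sym x₂→b
    embedding-preserves (suc (suc zero) , zero) (suc (suc zero) , zero) = sym (loopless x₂)

    embedding-injective : ∀ X Y → embedding X ≡ embedding Y → X ≡ Y
    embedding-injective (zero , zero)           (zero , zero)           _ = refl
    embedding-injective (zero , zero)           (suc zero , zero)       e = ⊥-elim (a≢x₀ (sym e))
    embedding-injective (zero , zero)           (suc zero , suc zero)   e = ⊥-elim (b≢x₀ (sym e))
    embedding-injective (zero , zero)           (suc (suc zero) , zero) e = ⊥-elim (x₀≢x₂ e)
    embedding-injective (suc zero , zero)       (zero , zero)           e = ⊥-elim (a≢x₀ e)
    embedding-injective (suc zero , zero)       (suc zero , zero)       _ = refl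
    embedding-injective (suc zero , zero)       (suc zero , suc zero)   e = ⊥-elim (a≢b e)
    embedding-injective (suc zero , zero)       (suc (suc zero) , zero) e = ⊥-elim (a≢x₂ e)
    embedding-injective (suc zero , suc zero)   (zero , zero)           e = ⊥-elim (b≢x₀ e)
    embedding-injective (suc zero , suc zero)   (suc zero , zero)       e = ⊥-elim (a≢b (sym e))
    embedding-injective (suc zero , suc zero)   (suc zero , suc zero)   _ = refl
    embedding-injective (suc zero , suc zero)   (suc (suc zero) , zero) e = ⊥-elim (b≢x₂ e)
    embedding-injective (suc (suc zero) , zero) (zero , zero)           e = ⊥-elim (x₀≢x₂ (sym e))
    embedding-injective (suc (suc zero) , zero) (suc zero , zero)       e = ⊥-elim (a≢x₂ (sym e))
    embedding-injective (suc (suc zero) , zero) (suc zero , suc zero)   e = ⊥-elim (b≢x₂ (sym e))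
    embedding-injective (suc (suc zero) , zero) (suc (suc zero) , zero) _ = refl

    embedding-surjective : ∀ c → ∃ λ X → embedding X ≡ c
    embedding-surjective c with vertex-cases c
    ... | inj₁ refl               = (zero , zero) , refl
    ... | inj₂ (inj₁ refl)        = (suc (suc zero) , zero) , refl
    ... | inj₂ (inj₂ (inj₁ refl)) = (suc zero , zero) , refl
    ... | inj₂ (inj₂ (inj₂ refl)) = (suc zero , suc zero) , refl

    isomorphic : Isomorphic A G₂[K₁,P₂,K₁]
    isomorphic = Isomorphic-sym
      (embedding , embedding-surjective , embedding-injective , embedding-preserves)

proposition4p13 : {n : ℕ} (A : DigraphOn (Fin n)) →
    Loopless A → StronglyConnected A → 4 ≤ n → HasDim A (n ∸ 2) →
    (x₀ x₁ x₂ : Fin n) →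
    Arc A x₀ x₁ → Arc A x₁ x₂ → Arc A x₂ x₀ → IsDist A x₀ x₂ 2 →
    ¬ IsClique A (λ x → IsDist A x₀ x 1) →
    ¬ IsIndependent A (λ x → IsDist A x₀ x 1) →
    (∃ λ z → IsDist A x₀ z 2 × (∀ y → IsDist A x₀ y 2 → y ≡ z)) →
    Isomorphic A G₂[K₁,P₂,K₁]
proposition4p13 A loopless _ _ dim x₀ x₁ x₂ x₀→x₁ _ x₂→x₀ ∂x₀x₂≡2 ¬clique ¬independent
                (z , _ , z-unique)
  with ¬IsClique⇒non-arc A (Distances.IsDist1? A _≟_ x₀) ¬clique
     | ¬IsIndependent⇒arc A (Distances.IsDist1? A _≟_ x₀) ¬independent
... | p , q , x₀⇝p , x₀⇝q , p≢q , p↛q | a , b , x₀⇝a , x₀⇝b , a→b =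
  Proposition.isomorphic A loopless dim x₀→x₁ x₂→x₀ ∂x₀x₂≡2 x₂-unique
    (IsDist1⇒arc x₀⇝p) (IsDist1⇒arc x₀⇝q) p≢q p↛q (IsDist1⇒arc x₀⇝a) (IsDist1⇒arc x₀⇝b) a→b
  where
  open Distances A
  x₂-unique : ∀ y → IsDist A x₀ y 2 → y ≡ x₂
  x₂-unique y ∂x₀y≡2 = trans (z-unique y ∂x₀y≡2) (sym (z-unique x₂ ∂x₀x₂≡2))
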